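{- Let $n\geq 1$ and let $H,G\leq W_n$ be non-cyclic subgroups such that $H\cap K_n=\{\mathrm{id}\}$, $|H|=|G|$, and $H$ is elementwise $K_n$-conjugate into $G$. Let $H_1,H_2$ be two distinct maximal subgroups of $H$, and suppose that $G=\langle H_1,H_2^a\rangle$ for some $a\in K_n$. Then $H$ is globally $K_n$-conjugate into $G$ if and only if $a\in C_{K_n}(H_1)\,C_{K_n}(x)$ for some $x\in H_2\setminus H_1$.
   Context: $T_n$ is the complete binary rooted tree with $n$ levels and $W_n=\mathrm{Aut}(T_n)$. Restriction to the first $n-1$ levels gives a surjection $\pi_n:W_n\to W_{n-1}$, and $K_n=\ker(\pi_n)$ (an elementary abelian $2$-group). For $x,a\in W_n$, $x^a=a^{ -1}xa$, and $S^a=a^{ -1}Sa$ for a subgroup $S$. $H$ is elementwise $K_n$-conjugate into $G$ if for every $h\in H$ there exists $c\in K_n$ with $h^c\in G$; $H$ is globally $K_n$-conjugate into $G$ if there exists $c\in K_n$ with $H^c\subseteq G$. For a subset $S\subseteq W_n$ (or an element $x$), $C_{K_n}(S)$ is the set of elements of $K_n$ commuting with every element of $S$, and $C_{K_n}(H_1)C_{K_n}(x)$ is the product set (a subgroup, as $K_n$ is abelian). -}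

module Defs where

open import Data.Nat using (ℕ; zero; suc)
open import Data.Bool using (Bool; true; false; not; _xor_; _∨_; T)
open import Data.Product using (Σ; ∃; _×_; _,_)
open import Data.Sum using (_⊎_)
open import Relation.Binary.PropositionalEquality using (_≡_)
open import Relation.Nullary using (¬_)
open import Function.Bundles using (_↔_)

-- W_n = Aut(T_n), elements given by their portraits.
-- A tree with n levels below the root: an automorphism of T_(suc n) is a
-- root label (swap the two subtrees or not) together with automorphisms
-- of the two subtrees (each a copy of T_n).

data W : ℕ → Set where
  leaf : W zero
  node : ∀ {n} → Bool → W n → W n → W (suc n)

e : ∀ {n} → W n
e {zero}  = leaf
e {suc n} = node false e e

-- f * g is the composite "first g, then f" (left action on vertices,
-- vertex b w ↦ (b xor s) f_b(w)).
_*_ : ∀ {n} → W n → W n → W n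
leaf * leaf = leaf
node s f0 f1 * node t g0 g1 with t
... | false = node (s xor false) (f0 * g0) (f1 * g1)
... | true  = node (s xor true)  (f1 * g0) (f0 * g1)

infixl 7 _*_

_⁻¹ : ∀ {n} → W n → W n
leaf ⁻¹ = leaf
node false f0 f1 ⁻¹ = node false (f0 ⁻¹) (f1 ⁻¹)
node true  f0 f1 ⁻¹ = node true  (f1 ⁻¹) (f0 ⁻¹)

infix 8 _⁻¹

_^_ : ∀ {n} → W n → W n → W n
x ^ a = a ⁻¹ * x * a

-- π_n : W_n → W_(n-1), restriction to the first n-1 levels
-- (forget the labels of the deepest level).
π : ∀ {n} → W (suc n) → W n
π {zero}  _ = leaf
π {suc n} (node s f0 f1) = node s (π f0) (π f1)

InK : ∀ {n} → W (suc n) → Set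
InK x = π x ≡ e

Subset : ℕ → Set
Subset n = W n → Bool

_∈_ : ∀ {n} → W n → Subset n → Set
x ∈ S = T (S x)

_∉_ : ∀ {n} → W n → Subset n → Set
x ∉ S = ¬ (x ∈ S)

infix 4 _∈_ _∉_

_⊆_ : ∀ {n} → Subset n → Subset n → Set
S ⊆ R = ∀ x → x ∈ S → x ∈ R

_≐_ : ∀ {n} → Subset n → Subset n → Set
S ≐ R = ∀ x → S x ≡ R x

_∪_ : ∀ {n} → Subset n → Subset n → Subset n
(S ∪ R) x = S x ∨ R x

_^ˢ_ : ∀ {n} → Subset n → W n → Subset n
(S ^ˢ a) x = S (a * x * a ⁻¹)

_≟W_ : ∀ {n} → W n → W n → Bool
leaf ≟W leaf = true
node s f0 f1 ≟W node t g0 g1 = (eqB s t) ∧' ((f0 ≟W g0) ∧' (f1 ≟W g1))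
  where
  eqB : Bool → Bool → Bool
  eqB a b = not (a xor b)
  _∧'_ : Bool → Bool → Bool
  true ∧' b = b
  false ∧' _ = false

｛_｝ : ∀ {n} → W n → Subset n
｛ g ｝ x = g ≟W x

SameCard : ∀ {n} → Subset n → Subset n → Set
SameCard {n} S R = (Σ (W n) λ x → x ∈ S) ↔ (Σ (W n) λ x → x ∈ R)

record IsSubgroup {n} (S : Subset n) : Set where
  field
    has-e : e ∈ S
    mul-closed : ∀ x y → x ∈ S → y ∈ S → x * y ∈ S
    inv-closed : ∀ x → x ∈ S → x ⁻¹ ∈ S

IsGeneratedBy : ∀ {n} → Subset n → Subset n → Set
IsGeneratedBy {n} G S =
  IsSubgroup G × S ⊆ G × (∀ (M : Subset n) → IsSubgroup M → S ⊆ M → G ⊆ M)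

IsCyclic : ∀ {n} → Subset n → Set
IsCyclic {n} H = ∃ λ (g : W n) → IsGeneratedBy H ｛ g ｝

IsMaximalSubgroup : ∀ {n} → Subset n → Subset n → Set
IsMaximalSubgroup {n} M H =
  IsSubgroup M × M ⊆ H × (∃ λ h → h ∈ H × h ∉ M) ×
  (∀ (L : Subset n) → IsSubgroup L → M ⊆ L → L ⊆ H → L ⊆ M ⊎ H ⊆ L)

-- K_n-conjugacy notions (W (suc m) = W_n with n = suc m ≥ 1)

ElementwiseKConj : ∀ {m} → Subset (suc m) → Subset (suc m) → Set
ElementwiseKConj H G = ∀ h → h ∈ H → ∃ λ c → InK c × (h ^ c) ∈ G

GloballyKConj : ∀ {m} → Subset (suc m) → Subset (suc m) → Set
GloballyKConj H G = ∃ λ c → InK c × (∀ h → h ∈ H → (h ^ c) ∈ G)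

InCK : ∀ {m} → Subset (suc m) → W (suc m) → Set
InCK S c = InK c × (∀ s → s ∈ S → c * s ≡ s * c)

InCKProd : ∀ {m} → Subset (suc m) → Subset (suc m) → W (suc m) → Set
InCKProd S R a = ∃ λ c₁ → ∃ λ c₂ → InCK S c₁ × InCK R c₂ × a ≡ c₁ * c₂

-- Since H ∩ K = 1, an element of H is determined by its image under π, and
-- conjugating by an element of K does not change that image.  So if H^c ⊆ G for
-- some c ∈ K, then H^c = G (equal finite orders), and every s ∈ H whose image
-- under a K-conjugation lies in G is sent there exactly as by c.  Applied to
-- H₁ ⊆ G this makes c centralise H₁; applied to x^a ∈ G for x ∈ H₂ ∖ H₁ it gives
-- x^a = x^c, so a c⁻¹ centralises x and a = c · (a c⁻¹).  Conversely, if
-- a = c₁ c₂ with c₁ centralising H₁ and c₂ centralising x, then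
-- {h ∈ H | h^c₁ ∈ G} is a subgroup containing H₁ and x (as x^c₁ = x^a), hence
-- all of H by maximality of H₁.
module Submission where

open import Algebra.Bundles using (Group)
open import Algebra.Structures using (IsGroup)
import Algebra.Properties.Group as GroupProperties
open import Data.Bool using (Bool; true; false; T; not; _xor_; _∧_)
open import Data.Bool.Properties using (T-∧; T-∨; T?; T-≡; T-irrelevant; ⇔→≡; xor-same)
open import Data.Fin using (Fin; zero; punchOut; _≟_)
open import Data.Fin.Properties using (any?; injective⇒≤; punchOut-injective; 2↔Bool; *↔×)
open import Data.Nat using (ℕ; zero; suc) renaming (_*_ to _*ℕ_)
open import Data.Nat.Properties using (1+n≰n)
open import Data.Product using (Σ; ∃; _×_; _,_; proj₁; proj₂)
open import Data.Product.Function.NonDependent.Propositional using (_×-↔_)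
open import Data.Sum using (inj₁; inj₂; [_,_]′)
open import Function using (_∘_; id; _∋_; case_of_)
open import Function.Bundles using (_⇔_; _↔_; mk⇔; mk↔ₛ′; Inverse; Injection; Equivalence)
open import Function.Definitions using (Injective; StrictlySurjective)
open import Function.Properties.Inverse using (↔-refl; ↔-sym; ↔-trans; ↔⇒↣)
open import Level using (0ℓ)
open import Relation.Binary.PropositionalEquality
  using (_≡_; _≢_; refl; sym; trans; cong; cong₂; subst; isEquivalence; module ≡-Reasoning)
open import Relation.Nullary using (¬_; Dec; yes; no; contradiction; _×-dec_; ¬?)
open import Relation.Nullary.Decidable using (map′; decidable-stable)
open import Relation.Unary using (Decidable)

Fin-injective⇒surjective : ∀ {k} {f : Fin k → Fin k} →
  Injective _≡_ _≡_ f → StrictlySurjective _≡_ f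
Fin-injective⇒surjective {suc k} {f} f-inj y with any? (λ x → f x ≟ y)
... | yes hit = hit
... | no miss = contradiction (injective⇒≤ squeezed-injective) 1+n≰n
  where
  y≢f : ∀ x → y ≢ f x
  y≢f x y≡fx = miss (x , sym y≡fx)

  squeezed : Fin (suc k) → Fin k
  squeezed x = punchOut (y≢f x)

  squeezed-injective : Injective _≡_ _≡_ squeezed
  squeezed-injective {x} {x′} = f-inj ∘ punchOut-injective (y≢f x) (y≢f x′)

module FiniteType {A : Set} {k : ℕ} (A↔Fin : A ↔ Fin k) where
  open Inverse A↔Fin

  private
    to-injective : Injective _≡_ _≡_ to
    to-injective = Injection.injective (↔⇒↣ A↔Fin)

    from-injective : Injective _≡_ _≡_ from
    from-injective = Injection.injective (↔⇒↣ (↔-sym A↔Fin))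

  ∃? : {P : A → Set} → Decidable P → Dec (∃ P)
  ∃? {P} P? = map′ (λ (i , p) → from i , p)
                   (λ (x , p) → to x , subst P (sym (strictlyInverseʳ x)) p)
                   (any? (P? ∘ from))

  injective⇒surjective : {f : A → A} → Injective _≡_ _≡_ f → StrictlySurjective _≡_ f
  injective⇒surjective {f} f-inj y
    with i , fi≡y ← Fin-injective⇒surjective {f = to ∘ f ∘ from}
                      (from-injective ∘ f-inj ∘ to-injective) (to y)
    = from i , to-injective fi≡y

  module _ (S : A → Bool) where

    ∈-≡ : ∀ {x y} {p : T (S x)} {q : T (S y)} → x ≡ y → (Σ A (T ∘ S) ∋ (x , p)) ≡ (y , q)
    ∈-≡ refl = cong (_ ,_) (T-irrelevant _ _)

    -- Extend g by the identity outside S to an injection of A, which is onto by finiteness.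
    subset-injective⇒surjective : {g : Σ A (T ∘ S) → Σ A (T ∘ S)} →
      Injective _≡_ _≡_ g → StrictlySurjective _≡_ g
    subset-injective⇒surjective {g} g-inj (y , y∈S) =
      let x , extend-x≡y = injective⇒surjective extend-injective y
      in  preimage (T? (S x)) extend-x≡y
      where
      extendAt : (x : A) → Dec (T (S x)) → A
      extendAt x (yes x∈S) = proj₁ (g (x , x∈S))
      extendAt x (no _)    = x

      extendAt-injective : ∀ {x x′} (d : Dec (T (S x))) (d′ : Dec (T (S x′))) →
        extendAt x d ≡ extendAt x′ d′ → x ≡ x′
      extendAt-injective (yes p) (yes p′) eq = cong proj₁ (g-inj (∈-≡ eq))
      extendAt-injective (no _)  (no _)   eq = eq
      extendAt-injective {x} (yes p) (no x′∉S) eq =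
        contradiction (subst (T ∘ S) eq (proj₂ (g (x , p)))) x′∉S
      extendAt-injective {x′ = x′} (no x∉S) (yes p′) eq =
        contradiction (subst (T ∘ S) (sym eq) (proj₂ (g (x′ , p′)))) x∉S

      extend-injective : Injective _≡_ _≡_ (λ x → extendAt x (T? (S x)))
      extend-injective {x} {x′} = extendAt-injective (T? (S x)) (T? (S x′))

      preimage : ∀ {x} (d : Dec (T (S x))) → extendAt x d ≡ y → ∃ λ u → g u ≡ (y , y∈S)
      preimage {x} (yes x∈S) eq = (x , x∈S) , ∈-≡ eq
      preimage (no x∉S) refl = contradiction y∈S x∉S

  equinumerous-injective⇒surjective : {S R : A → Bool} →
    Σ A (T ∘ S) ↔ Σ A (T ∘ R) → {f : Σ A (T ∘ S) → Σ A (T ∘ R)} →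
    Injective _≡_ _≡_ f → StrictlySurjective _≡_ f
  equinumerous-injective⇒surjective {R = R} S↔R {f} f-inj v
    with u , eq ← subset-injective⇒surjective R (Injection.injective (↔⇒↣ (↔-sym S↔R)) ∘ f-inj) v
    = Inverse.from S↔R u , eq

module Conjugation {c ℓ} (𝔾 : Group c ℓ) where
  open Group 𝔾 hiding (refl; sym; trans; setoid)
  open GroupProperties 𝔾
  open import Relation.Binary.Reasoning.Setoid (Group.setoid 𝔾)

  _^_ : Carrier → Carrier → Carrier
  x ^ a = a ⁻¹ ∙ x ∙ a

  ^-congˡ : ∀ {x y} a → x ≈ y → x ^ a ≈ y ^ a
  ^-congˡ a x≈y = ∙-congʳ (∙-congˡ x≈y)

  ^-congʳ : ∀ x {a b} → a ≈ b → x ^ a ≈ x ^ b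
  ^-congʳ x a≈b = ∙-cong (∙-congʳ (⁻¹-cong a≈b)) a≈b

  ^-identityʳ : ∀ x → x ^ ε ≈ x
  ^-identityʳ x = begin
    ε ⁻¹ ∙ x ∙ ε  ≈⟨ identityʳ _ ⟩
    ε ⁻¹ ∙ x      ≈⟨ ∙-congʳ ε⁻¹≈ε ⟩
    ε ∙ x         ≈⟨ identityˡ x ⟩
    x             ∎

  ε-^ : ∀ a → ε ^ a ≈ ε
  ε-^ a = begin
    a ⁻¹ ∙ ε ∙ a  ≈⟨ ∙-congʳ (identityʳ (a ⁻¹)) ⟩
    a ⁻¹ ∙ a      ≈⟨ inverseˡ a ⟩
    ε             ∎

  ^-homo-∙ : ∀ x y a → (x ∙ y) ^ a ≈ x ^ a ∙ y ^ a
  ^-homo-∙ x y a = begin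
    a ⁻¹ ∙ (x ∙ y) ∙ a                ≈⟨ ∙-congʳ (assoc _ x y) ⟨
    a ⁻¹ ∙ x ∙ y ∙ a                  ≈⟨ ∙-congʳ (∙-congˡ (\\-leftDividesˡ a y)) ⟨
    a ⁻¹ ∙ x ∙ (a ∙ (a ⁻¹ ∙ y)) ∙ a   ≈⟨ ∙-congʳ (assoc _ a _) ⟨
    a ⁻¹ ∙ x ∙ a ∙ (a ⁻¹ ∙ y) ∙ a     ≈⟨ assoc _ _ a ⟩
    x ^ a ∙ y ^ a                     ∎

  ^-homo-⁻¹ : ∀ x a → (x ⁻¹) ^ a ≈ (x ^ a) ⁻¹
  ^-homo-⁻¹ x a = inverseʳ-unique (x ^ a) ((x ⁻¹) ^ a) (begin
    x ^ a ∙ (x ⁻¹) ^ a  ≈⟨ ^-homo-∙ x (x ⁻¹) a ⟨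
    (x ∙ x ⁻¹) ^ a      ≈⟨ ^-congˡ a (inverseʳ x) ⟩
    ε ^ a               ≈⟨ ε-^ a ⟩
    ε                   ∎)

  ^-∙ : ∀ x a b → x ^ (a ∙ b) ≈ (x ^ a) ^ b
  ^-∙ x a b = begin
    (a ∙ b) ⁻¹ ∙ x ∙ (a ∙ b)   ≈⟨ ∙-congʳ (∙-congʳ (⁻¹-anti-homo-∙ a b)) ⟩
    b ⁻¹ ∙ a ⁻¹ ∙ x ∙ (a ∙ b)  ≈⟨ assoc _ a b ⟨
    b ⁻¹ ∙ a ⁻¹ ∙ x ∙ a ∙ b    ≈⟨ ∙-congʳ (∙-congʳ (assoc (b ⁻¹) (a ⁻¹) x)) ⟩
    b ⁻¹ ∙ (a ⁻¹ ∙ x) ∙ a ∙ b  ≈⟨ ∙-congʳ (assoc (b ⁻¹) _ a) ⟩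
    (x ^ a) ^ b                ∎

  ^-cancel : ∀ x a → a ∙ x ^ a ∙ a ⁻¹ ≈ x
  ^-cancel x a = begin
    a ∙ (a ⁻¹ ∙ x ∙ a) ∙ a ⁻¹    ≈⟨ ∙-congʳ (assoc a _ a) ⟨
    a ∙ (a ⁻¹ ∙ x) ∙ a ∙ a ⁻¹    ≈⟨ //-rightDividesʳ a _ ⟩
    a ∙ (a ⁻¹ ∙ x)               ≈⟨ \\-leftDividesˡ a x ⟩
    x                            ∎

  ^-injective : ∀ {x y} a → x ^ a ≈ y ^ a → x ≈ y
  ^-injective {x} {y} a eq = begin
    x                  ≈⟨ ^-cancel x a ⟨
    a ∙ x ^ a ∙ a ⁻¹   ≈⟨ ∙-congʳ (∙-congˡ eq) ⟩
    a ∙ y ^ a ∙ a ⁻¹   ≈⟨ ^-cancel y a ⟩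
    y                  ∎

  ^-fixed⇒comm : ∀ {x a} → x ^ a ≈ x → a ∙ x ≈ x ∙ a
  ^-fixed⇒comm {x} {a} fixed = begin
    a ∙ x                ≈⟨ ∙-congˡ fixed ⟨
    a ∙ (a ⁻¹ ∙ x ∙ a)   ≈⟨ assoc a _ a ⟨
    a ∙ (a ⁻¹ ∙ x) ∙ a   ≈⟨ ∙-congʳ (\\-leftDividesˡ a x) ⟩
    x ∙ a                ∎

  comm⇒^-fixed : ∀ {x a} → a ∙ x ≈ x ∙ a → x ^ a ≈ x
  comm⇒^-fixed {x} {a} comm = begin
    a ⁻¹ ∙ x ∙ a     ≈⟨ assoc _ x a ⟩
    a ⁻¹ ∙ (x ∙ a)   ≈⟨ ∙-congˡ comm ⟨
    a ⁻¹ ∙ (a ∙ x)   ≈⟨ \\-leftDividesʳ a x ⟩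
    x                ∎

  ^-≈⇒//-fixes : ∀ {x a b} → x ^ a ≈ x ^ b → x ^ (a // b) ≈ x
  ^-≈⇒//-fixes {x} {a} {b} eq = begin
    x ^ (a ∙ b ⁻¹)     ≈⟨ ^-∙ x a (b ⁻¹) ⟩
    (x ^ a) ^ (b ⁻¹)   ≈⟨ ^-congˡ (b ⁻¹) eq ⟩
    (x ^ b) ^ (b ⁻¹)   ≈⟨ ^-∙ x b (b ⁻¹) ⟨
    x ^ (b ∙ b ⁻¹)     ≈⟨ ^-congʳ x (inverseʳ b) ⟩
    x ^ ε              ≈⟨ ^-identityʳ x ⟩
    x                  ∎

open import Defs

*-assoc : ∀ {n} (x y z : W n) → x * y * z ≡ x * (y * z)
*-assoc leaf leaf leaf = refl
*-assoc (node false x₀ x₁) (node false y₀ y₁) (node false z₀ z₁) = cong₂ (node _) (*-assoc x₀ y₀ z₀) (*-assoc x₁ y₁ z₁)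
*-assoc (node true  x₀ x₁) (node false y₀ y₁) (node false z₀ z₁) = cong₂ (node _) (*-assoc x₀ y₀ z₀) (*-assoc x₁ y₁ z₁)
*-assoc (node false x₀ x₁) (node false y₀ y₁) (node true  z₀ z₁) = cong₂ (node _) (*-assoc x₁ y₁ z₀) (*-assoc x₀ y₀ z₁)
*-assoc (node true  x₀ x₁) (node false y₀ y₁) (node true  z₀ z₁) = cong₂ (node _) (*-assoc x₁ y₁ z₀) (*-assoc x₀ y₀ z₁)
*-assoc (node false x₀ x₁) (node true  y₀ y₁) (node false z₀ z₁) = cong₂ (node _) (*-assoc x₁ y₀ z₀) (*-assoc x₀ y₁ z₁)
*-assoc (node true  x₀ x₁) (node true  y₀ y₁) (node false z₀ z₁) = cong₂ (node _) (*-assoc x₁ y₀ z₀) (*-assoc x₀ y₁ z₁)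
*-assoc (node false x₀ x₁) (node true  y₀ y₁) (node true  z₀ z₁) = cong₂ (node _) (*-assoc x₀ y₁ z₀) (*-assoc x₁ y₀ z₁)
*-assoc (node true  x₀ x₁) (node true  y₀ y₁) (node true  z₀ z₁) = cong₂ (node _) (*-assoc x₀ y₁ z₀) (*-assoc x₁ y₀ z₁)

*-identityˡ : ∀ {n} (x : W n) → e * x ≡ x
*-identityˡ leaf = refl
*-identityˡ (node false x₀ x₁) = cong₂ (node _) (*-identityˡ x₀) (*-identityˡ x₁)
*-identityˡ (node true  x₀ x₁) = cong₂ (node _) (*-identityˡ x₀) (*-identityˡ x₁)

*-identityʳ : ∀ {n} (x : W n) → x * e ≡ x
*-identityʳ leaf = refl
*-identityʳ (node false x₀ x₁) = cong₂ (node _) (*-identityʳ x₀) (*-identityʳ x₁)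
*-identityʳ (node true  x₀ x₁) = cong₂ (node _) (*-identityʳ x₀) (*-identityʳ x₁)

⁻¹-inverseˡ : ∀ {n} (x : W n) → x ⁻¹ * x ≡ e
⁻¹-inverseˡ leaf = refl
⁻¹-inverseˡ (node false x₀ x₁) = cong₂ (node _) (⁻¹-inverseˡ x₀) (⁻¹-inverseˡ x₁)
⁻¹-inverseˡ (node true  x₀ x₁) = cong₂ (node _) (⁻¹-inverseˡ x₀) (⁻¹-inverseˡ x₁)

⁻¹-inverseʳ : ∀ {n} (x : W n) → x * x ⁻¹ ≡ e
⁻¹-inverseʳ leaf = refl
⁻¹-inverseʳ (node false x₀ x₁) = cong₂ (node _) (⁻¹-inverseʳ x₀) (⁻¹-inverseʳ x₁)
⁻¹-inverseʳ (node true  x₀ x₁) = cong₂ (node _) (⁻¹-inverseʳ x₁) (⁻¹-inverseʳ x₀)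

W-isGroup : ∀ n → IsGroup _≡_ (_*_ {n}) e _⁻¹
W-isGroup n = record
  { isMonoid = record
    { isSemigroup = record
      { isMagma = record { isEquivalence = isEquivalence ; ∙-cong = cong₂ _*_ }
      ; assoc   = *-assoc
      }
    ; identity = *-identityˡ , *-identityʳ
    }
  ; inverse = ⁻¹-inverseˡ , ⁻¹-inverseʳ
  ; ⁻¹-cong = cong _⁻¹
  }

W-group : ℕ → Group 0ℓ 0ℓ
W-group n = record { isGroup = W-isGroup n }

module W-Properties {n : ℕ} = GroupProperties (W-group n)
module W-Conjugation {n : ℕ} = Conjugation (W-group n)
open W-Properties using (ε⁻¹≈ε; x∙y⁻¹≈ε⇒x≈y; x≈y⇒x∙y⁻¹≈ε; //-rightDividesˡ)
-- Conjugation._^_ for W-group n unfolds to Defs._^_.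
open W-Conjugation hiding (_^_)

size : ℕ → ℕ
size zero    = 1
size (suc n) = 2 *ℕ (size n *ℕ size n)

node↔ : ∀ {n} → W (suc n) ↔ (Bool × W n × W n)
node↔ = mk↔ₛ′ (λ { (node s l r) → s , l , r }) (λ (s , l , r) → node s l r)
              (λ _ → refl) (λ { (node s l r) → refl })

W↔Fin : ∀ n → W n ↔ Fin (size n)
W↔Fin zero    = mk↔ₛ′ (λ _ → zero) (λ _ → leaf) (λ { zero → refl }) (λ { leaf → refl })
W↔Fin (suc n) =
  ↔-trans node↔
  (↔-trans (↔-sym 2↔Bool ×-↔ (W↔Fin n ×-↔ W↔Fin n))
  (↔-trans (↔-refl ×-↔ ↔-sym *↔×)
           (↔-sym *↔×)))

module _ {n : ℕ} where
  open FiniteType (W↔Fin n) public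
    using (∃?; equinumerous-injective⇒surjective; ∈-≡)

node-injective : ∀ {n s t} {l r l′ r′ : W n} → node s l r ≡ node t l′ r′ → l ≡ l′ × r ≡ r′
node-injective refl = refl , refl

π-homo-* : ∀ {n} (x y : W (suc n)) → π (x * y) ≡ π x * π y
π-homo-* {zero}  _ _ = refl
π-homo-* {suc n} (node s x₀ x₁) (node false y₀ y₁) = cong₂ (node _) (π-homo-* x₀ y₀) (π-homo-* x₁ y₁)
π-homo-* {suc n} (node s x₀ x₁) (node true  y₀ y₁) = cong₂ (node _) (π-homo-* x₁ y₀) (π-homo-* x₀ y₁)

π-homo-⁻¹ : ∀ {n} (x : W (suc n)) → π (x ⁻¹) ≡ π x ⁻¹
π-homo-⁻¹ {zero}  _ = refl
π-homo-⁻¹ {suc n} (node false x₀ x₁) = cong₂ (node _) (π-homo-⁻¹ x₀) (π-homo-⁻¹ x₁)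
π-homo-⁻¹ {suc n} (node true  x₀ x₁) = cong₂ (node _) (π-homo-⁻¹ x₁) (π-homo-⁻¹ x₀)

π-homo-^ : ∀ {n} (x a : W (suc n)) → π (x ^ a) ≡ π x ^ π a
π-homo-^ x a = begin
  π (a ⁻¹ * x * a)     ≡⟨ π-homo-* _ a ⟩
  π (a ⁻¹ * x) * π a   ≡⟨ cong (_* π a) (π-homo-* _ x) ⟩
  π (a ⁻¹) * π x * π a ≡⟨ cong (λ z → z * π x * π a) (π-homo-⁻¹ a) ⟩
  π x ^ π a            ∎
  where open ≡-Reasoning

module _ {m : ℕ} where

  InK-* : {x y : W (suc m)} → InK x → InK y → InK (x * y)
  InK-* {x} {y} x∈K y∈K = trans (π-homo-* x y) (trans (cong₂ _*_ x∈K y∈K) (*-identityˡ e))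

  InK-⁻¹ : {x : W (suc m)} → InK x → InK (x ⁻¹)
  InK-⁻¹ {x} x∈K = trans (π-homo-⁻¹ x) (trans (cong _⁻¹ x∈K) ε⁻¹≈ε)

  π-^-K : {x c : W (suc m)} → InK c → π (x ^ c) ≡ π x
  π-^-K {x} {c} c∈K = trans (π-homo-^ x c) (trans (cong (π x ^_) c∈K) (^-identityʳ (π x)))

K-comm : ∀ {m} {x y : W (suc m)} → InK x → InK y → x * y ≡ y * x
K-comm {zero} {node false leaf leaf} {node false leaf leaf} _ _ = refl
K-comm {zero} {node false leaf leaf} {node true  leaf leaf} _ _ = refl
K-comm {zero} {node true  leaf leaf} {node false leaf leaf} _ _ = refl
K-comm {zero} {node true  leaf leaf} {node true  leaf leaf} _ _ = refl
K-comm {suc m} {node false _ _} {node false _ _} x∈K y∈K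
  with x₀∈K , x₁∈K ← node-injective x∈K | y₀∈K , y₁∈K ← node-injective y∈K
  = cong₂ (node false) (K-comm x₀∈K y₀∈K) (K-comm x₁∈K y₁∈K)
K-comm {suc m} {node true  _ _} {_}              () _
K-comm {suc m} {node false _ _} {node true  _ _} _  ()

≟W-node : ∀ {n} s t (l r l′ r′ : W n) →
  (node s l r ≟W node t l′ r′) ≡ not (s xor t) ∧ ((l ≟W l′) ∧ (r ≟W r′))
≟W-node s t l r l′ r′ with not (s xor t) | l ≟W l′
... | false | _     = refl
... | true  | false = refl
... | true  | true  = refl

xnor-sound : ∀ {s t} → T (not (s xor t)) → s ≡ t
xnor-sound {false} {false} _ = refl
xnor-sound {true}  {true}  _ = refl
xnor-sound {false} {true}  ()
xnor-sound {true}  {false} ()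

xnor-refl : ∀ s → T (not (s xor s))
xnor-refl s = subst (T ∘ not) (sym (xor-same s)) _

≟W-sound : ∀ {n} {x y : W n} → T (x ≟W y) → x ≡ y
≟W-sound {x = leaf} {leaf} _ = refl
≟W-sound {x = node s l r} {node t l′ r′} x≟y
  with s≟t , l≟l′∧r≟r′ ← Equivalence.to T-∧ (subst T (≟W-node s t l r l′ r′) x≟y)
  with l≟l′ , r≟r′ ← Equivalence.to T-∧ l≟l′∧r≟r′
  with refl ← xnor-sound {s} {t} s≟t | refl ← ≟W-sound {x = l} {l′} l≟l′ | refl ← ≟W-sound {x = r} {r′} r≟r′
  = refl

≟W-refl : ∀ {n} (x : W n) → T (x ≟W x)
≟W-refl leaf = _
≟W-refl (node s l r) = subst T (sym (≟W-node s s l r l r))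
  (Equivalence.from T-∧ (xnor-refl s , Equivalence.from T-∧ (≟W-refl l , ≟W-refl r)))

module _ {m : ℕ} {x c : W (suc m)} where

  InCK-｛｝ : InK c → c * x ≡ x * c → InCK ｛ x ｝ c
  InCK-｛｝ c∈K comm = c∈K , λ s s∈｛x｝ → subst (λ s → c * s ≡ s * c) (≟W-sound s∈｛x｝) comm

  InCK-｛｝-comm : InCK ｛ x ｝ c → c * x ≡ x * c
  InCK-｛｝-comm (_ , comm) = comm x (≟W-refl x)

module _ {n : ℕ} where

  _∩_ : Subset n → Subset n → Subset n
  (S ∩ R) x = S x ∧ R x

  conjPreimage : W n → Subset n → Subset n
  conjPreimage a S x = S (x ^ a)

  ⊆-antisym : ∀ {S R : Subset n} → S ⊆ R → R ⊆ S → S ≐ R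
  ⊆-antisym S⊆R R⊆S x = ⇔→≡ {z = true} (mk⇔
    (Equivalence.to T-≡ ∘ S⊆R x ∘ Equivalence.from T-≡)
    (Equivalence.to T-≡ ∘ R⊆S x ∘ Equivalence.from T-≡))

  ∈-^ˢ : ∀ {S : Subset n} {x} a → x ∈ S → x ^ a ∈ S ^ˢ a
  ∈-^ˢ {S} {x} a = subst (_∈ S) (sym (^-cancel x a))

  conjPreimage-isSubgroup : ∀ {S : Subset n} a → IsSubgroup S → IsSubgroup (conjPreimage a S)
  conjPreimage-isSubgroup {S} a S-sub = record
    { has-e      = subst (_∈ S) (sym (ε-^ a)) S.has-e
    ; mul-closed = λ x y x∈ y∈ → subst (_∈ S) (sym (^-homo-∙ x y a)) (S.mul-closed _ _ x∈ y∈)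
    ; inv-closed = λ x x∈ → subst (_∈ S) (sym (^-homo-⁻¹ x a)) (S.inv-closed _ x∈)
    }
    where module S = IsSubgroup S-sub

  module _ {S R : Subset n} where

    ∈-∩ : ∀ {x} → x ∈ S → x ∈ R → x ∈ S ∩ R
    ∈-∩ x∈S x∈R = Equivalence.from T-∧ (x∈S , x∈R)

    ∩-⊆ˡ : (S ∩ R) ⊆ S
    ∩-⊆ˡ x = proj₁ ∘ Equivalence.to T-∧

    ∩-⊆ʳ : (S ∩ R) ⊆ R
    ∩-⊆ʳ x = proj₂ ∘ Equivalence.to T-∧

    ∩-isSubgroup : IsSubgroup S → IsSubgroup R → IsSubgroup (S ∩ R)
    ∩-isSubgroup S-sub R-sub = record
      { has-e      = ∈-∩ S.has-e R.has-e
      ; mul-closed = λ x y x∈ y∈ →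
          ∈-∩ (S.mul-closed x y (∩-⊆ˡ x x∈) (∩-⊆ˡ y y∈)) (R.mul-closed x y (∩-⊆ʳ x x∈) (∩-⊆ʳ y y∈))
      ; inv-closed = λ x x∈ → ∈-∩ (S.inv-closed x (∩-⊆ˡ x x∈)) (R.inv-closed x (∩-⊆ʳ x x∈))
      }
      where
      module S = IsSubgroup S-sub
      module R = IsSubgroup R-sub

  maximal⇒⊆ : ∀ {M H L : Subset n} {x} → IsMaximalSubgroup M H → IsSubgroup L →
    M ⊆ L → L ⊆ H → x ∈ L → x ∉ M → H ⊆ L
  maximal⇒⊆ (_ , _ , _ , maximal) L-sub M⊆L L⊆H x∈L x∉M =
    [ (λ L⊆M → contradiction (L⊆M _ x∈L) x∉M) , id ]′ (maximal _ L-sub M⊆L L⊆H)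

  distinct-maximal⇒∃∉ : ∀ {M₁ M₂ H : Subset n} → IsMaximalSubgroup M₁ H → IsMaximalSubgroup M₂ H →
    ¬ (M₁ ≐ M₂) → ∃ λ x → x ∈ M₂ × x ∉ M₁
  distinct-maximal⇒∃∉ {M₁} {M₂} (M₁-sub , M₁⊆H , (h , h∈H , h∉M₁) , _) (_ , _ , _ , M₂-maximal) M₁≠M₂
    with ∃? (λ x → T? (M₂ x) ×-dec ¬? (T? (M₁ x)))
  ... | yes found = found
  ... | no none =
    [ (λ M₁⊆M₂ → contradiction (⊆-antisym M₁⊆M₂ M₂⊆M₁) M₁≠M₂)
    , (λ H⊆M₁ → contradiction (H⊆M₁ h h∈H) h∉M₁)
    ]′ (M₂-maximal M₁ M₁-sub M₂⊆M₁ M₁⊆H)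
    where
    M₂⊆M₁ : M₂ ⊆ M₁
    M₂⊆M₁ x x∈M₂ = decidable-stable (T? (M₁ x)) (λ x∉M₁ → none (x , x∈M₂ , x∉M₁))

module _ {m : ℕ} {H : Subset (suc m)} (H-sub : IsSubgroup H)
         (H∩K-trivial : ∀ h → h ∈ H → InK h → h ≡ e) where
  open IsSubgroup H-sub

  π-injective-on : ∀ {h k} → h ∈ H → k ∈ H → π h ≡ π k → h ≡ k
  π-injective-on {h} {k} h∈H k∈H πh≡πk =
    x∙y⁻¹≈ε⇒x≈y h k (H∩K-trivial (h * k ⁻¹) (mul-closed h (k ⁻¹) h∈H (inv-closed k k∈H)) hk⁻¹∈K)
    where
    hk⁻¹∈K : InK (h * k ⁻¹)
    hk⁻¹∈K = trans (π-homo-* h (k ⁻¹)) (trans (cong (π h *_) (π-homo-⁻¹ k)) (x≈y⇒x∙y⁻¹≈ε πh≡πk))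

  module _ {G : Subset (suc m)} {c : W (suc m)} (|H|≡|G| : SameCard H G) (c∈K : InK c)
           (Hᶜ⊆G : ∀ h → h ∈ H → h ^ c ∈ G) where

    conj : Σ (W (suc m)) (_∈ H) → Σ (W (suc m)) (_∈ G)
    conj (h , h∈H) = h ^ c , Hᶜ⊆G h h∈H

    conj-injective : Injective _≡_ _≡_ conj
    conj-injective eq = ∈-≡ H (^-injective c (cong proj₁ eq))

    conj-surjective : StrictlySurjective _≡_ conj
    conj-surjective = equinumerous-injective⇒surjective {S = H} {R = G} |H|≡|G| conj-injective

    ^-onto : ∀ {g} → g ∈ G → ∃ λ h → h ∈ H × h ^ c ≡ g
    ^-onto g∈G = let (h , h∈H) , conj-h≡g = conj-surjective (_ , g∈G) in h , h∈H , cong proj₁ conj-h≡g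

    ≡-^-of-same-π : ∀ {s g} → s ∈ H → g ∈ G → π g ≡ π s → g ≡ s ^ c
    ≡-^-of-same-π s∈H g∈G πg≡πs = case ^-onto g∈G of λ where
      (h , h∈H , refl) → cong (_^ c) (π-injective-on h∈H s∈H (trans (sym (π-^-K c∈K)) πg≡πs))

    globallyKConj⇒∈CKProd : ∀ {H₁ x a} → H₁ ⊆ H → H₁ ⊆ G → x ∈ H → x ^ a ∈ G → InK a →
      InCKProd H₁ ｛ x ｝ a
    globallyKConj⇒∈CKProd {H₁} {x} {a} H₁⊆H H₁⊆G x∈H xᵃ∈G a∈K =
      c , a * c ⁻¹ , (c∈K , c-centralises-H₁) , InCK-｛｝ ac⁻¹∈K ac⁻¹-centralises-x , a≡c·ac⁻¹
      where
      ac⁻¹∈K : InK (a * c ⁻¹)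
      ac⁻¹∈K = InK-* a∈K (InK-⁻¹ c∈K)

      c-centralises-H₁ : ∀ s → s ∈ H₁ → c * s ≡ s * c
      c-centralises-H₁ s s∈H₁ =
        ^-fixed⇒comm {x = s} {a = c} (sym (≡-^-of-same-π (H₁⊆H s s∈H₁) (H₁⊆G s s∈H₁) refl))

      ac⁻¹-centralises-x : a * c ⁻¹ * x ≡ x * (a * c ⁻¹)
      ac⁻¹-centralises-x =
        ^-fixed⇒comm (^-≈⇒//-fixes {x = x} {a = a} {b = c} (≡-^-of-same-π x∈H xᵃ∈G (π-^-K a∈K)))

      a≡c·ac⁻¹ : a ≡ c * (a * c ⁻¹)
      a≡c·ac⁻¹ = sym (trans (K-comm c∈K ac⁻¹∈K) (//-rightDividesˡ c a))

∈CKProd⇒globallyKConj : ∀ {m} {H G H₁ : Subset (suc m)} {x a} →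
  IsSubgroup H → IsSubgroup G → IsMaximalSubgroup H₁ H →
  H₁ ⊆ G → x ∈ H → x ∉ H₁ → x ^ a ∈ G → InCKProd H₁ ｛ x ｝ a → GloballyKConj H G
∈CKProd⇒globallyKConj {m} {H} {G} {H₁} {x} H-sub G-sub H₁-max@(_ , H₁⊆H , _) H₁⊆G x∈H x∉H₁ xᵃ∈G
  (c₁ , c₂ , (c₁∈K , c₁-centralises-H₁) , c₂∈CK , refl) =
  c₁ , c₁∈K , λ h h∈H → ∩-⊆ʳ {S = H} {R = conjPreimage c₁ G} h (H⊆L h h∈H)
  where
  L : Subset (suc m)
  L = H ∩ conjPreimage c₁ G

  ∈L : ∀ {h} → h ∈ H → h ^ c₁ ∈ G → h ∈ L
  ∈L = ∈-∩ {S = H} {R = conjPreimage c₁ G}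

  H₁⊆L : H₁ ⊆ L
  H₁⊆L s s∈H₁ = ∈L (H₁⊆H s s∈H₁)
    (subst (_∈ G) (sym (comm⇒^-fixed {x = s} {a = c₁} (c₁-centralises-H₁ s s∈H₁))) (H₁⊆G s s∈H₁))

  xᵃ≡xᶜ¹ : x ^ (c₁ * c₂) ≡ x ^ c₁
  xᵃ≡xᶜ¹ = begin
    x ^ (c₁ * c₂)   ≡⟨ cong (x ^_) (K-comm c₁∈K (proj₁ c₂∈CK)) ⟩
    x ^ (c₂ * c₁)   ≡⟨ ^-∙ x c₂ c₁ ⟩
    (x ^ c₂) ^ c₁   ≡⟨ cong (_^ c₁) (comm⇒^-fixed {x = x} {a = c₂} (InCK-｛｝-comm c₂∈CK)) ⟩
    x ^ c₁          ∎
    where open ≡-Reasoning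

  H⊆L : H ⊆ L
  H⊆L = maximal⇒⊆ H₁-max (∩-isSubgroup H-sub (conjPreimage-isSubgroup c₁ G-sub))
    H₁⊆L (∩-⊆ˡ {S = H}) (∈L x∈H (subst (_∈ G) xᵃ≡xᶜ¹ xᵃ∈G)) x∉H₁

lemma4p4 : (m : ℕ) (H G H₁ H₂ : Subset (suc m)) (a : W (suc m)) →
    IsSubgroup H → IsSubgroup G → ¬ IsCyclic H → ¬ IsCyclic G →
    (∀ h → h ∈ H → InK h → h ≡ e) →
    SameCard H G →
    ElementwiseKConj H G →
    IsMaximalSubgroup H₁ H → IsMaximalSubgroup H₂ H → ¬ (H₁ ≐ H₂) →
    InK a → IsGeneratedBy G (H₁ ∪ (H₂ ^ˢ a)) →
    GloballyKConj H G ⇔ (∃ λ x → x ∈ H₂ × x ∉ H₁ × InCKProd H₁ ｛ x ｝ a)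
lemma4p4 m H G H₁ H₂ a H-sub G-sub _ _ H∩K-trivial |H|≡|G| _
  H₁-max@(_ , H₁⊆H , _) H₂-max@(_ , H₂⊆H , _) H₁≢H₂ a∈K (_ , H₁∪H₂ᵃ⊆G , _) =
  mk⇔
    (λ (c , c∈K , Hᶜ⊆G) →
      let x , x∈H₂ , x∉H₁ = distinct-maximal⇒∃∉ H₁-max H₂-max H₁≢H₂
      in  x , x∈H₂ , x∉H₁ , globallyKConj⇒∈CKProd H-sub H∩K-trivial |H|≡|G| c∈K Hᶜ⊆G
                              H₁⊆H H₁⊆G (H₂⊆H x x∈H₂) (H₂ᵃ⊆G x∈H₂) a∈K)
    (λ (x , x∈H₂ , x∉H₁ , a∈CC) →
      ∈CKProd⇒globallyKConj H-sub G-sub H₁-max H₁⊆G (H₂⊆H x x∈H₂) x∉H₁ (H₂ᵃ⊆G x∈H₂) a∈CC)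
  where
  H₁⊆G : H₁ ⊆ G
  H₁⊆G s s∈H₁ = H₁∪H₂ᵃ⊆G s (Equivalence.from T-∨ (inj₁ s∈H₁))

  H₂ᵃ⊆G : ∀ {x} → x ∈ H₂ → x ^ a ∈ G
  H₂ᵃ⊆G {x} x∈H₂ = H₁∪H₂ᵃ⊆G (x ^ a) (Equivalence.from T-∨ (inj₂ (∈-^ˢ {S = H₂} a x∈H₂)))
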